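{- Let $(a_n)_{n \ge 0}$ be the sequence defined by $a_0 = 0$ and $a_n = \frac{n}{2} a_{n-1} + (n-1)!$ for all $n \geq 1$. Then $a_n \in \mathbb{Z}$ for every natural number $n$. -}

module Defs where

open import Data.Nat using (ℕ; zero; suc; _!)
open import Data.Integer using (ℤ; +_)
open import Data.Rational using (ℚ; _/_; _+_; _*_; 0ℚ)

a : ℕ → ℚ
a zero    = 0ℚ
a (suc n) = ((+ suc n) / 2) * a n + ((+ (n !)) / 1)

{-# OPTIONS --safe #-}
-- a (n + 1) = Σ_{i + j = n} i! j!, a natural number.  This sum satisfies the
-- recurrence 2 a (n + 2) = (n + 2) a (n + 1) + 2 (n + 1)! because splitting
-- (n + 2) i! j! = (i + 1)! j! + i! (j + 1)! turns (n + 2) a (n + 1) into two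
-- reindexed copies of a (n + 2), each missing one boundary term (n + 1)!.
module Submission where

open import Defs
open import Data.Nat using (ℕ; zero; suc; _+_; _*_; _!; NonZero)
open import Data.Nat.Properties using (+-suc; +-assoc)
open import Data.Nat.Solver using (module +-*-Solver)
open import Data.Integer as ℤ using (ℤ; +_)
import Data.Integer.Properties as ℤ
open import Data.Integer.Solver renaming (module +-*-Solver to ℤ-Solver)
open import Data.Rational as ℚ using (_/_; toℚᵘ)
open import Data.Rational.Properties using (toℚᵘ-injective; toℚᵘ-fromℚᵘ; toℚᵘ-homo-+; toℚᵘ-homo-*)
import Data.Rational.Unnormalised as ℚᵘ
import Data.Rational.Unnormalised.Properties as ℚᵘ
open import Data.Product using (∃; _,_)
open import Function using (_∘_)
open import Relation.Binary.PropositionalEquality using (_≡_; refl; sym; trans; cong; cong₂; module ≡-Reasoning)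

_⋆_ : (ℕ → ℕ) → (ℕ → ℕ) → ℕ → ℕ
(f ⋆ g) zero    = f 0 * g 0
(f ⋆ g) (suc n) = f 0 * g (suc n) + ((f ∘ suc) ⋆ g) n

⋆-congˡ : ∀ {f f′} g → (∀ i → f i ≡ f′ i) → ∀ n → (f ⋆ g) n ≡ (f′ ⋆ g) n
⋆-congˡ g f≗f′ zero    = cong (_* g 0) (f≗f′ 0)
⋆-congˡ g f≗f′ (suc n) = cong₂ _+_ (cong (_* g (suc n)) (f≗f′ 0)) (⋆-congˡ g (f≗f′ ∘ suc) n)

⋆-sucʳ : ∀ f g n → (f ⋆ g) (suc n) ≡ (f ⋆ (g ∘ suc)) n + f (suc n) * g 0
⋆-sucʳ f g zero    = refl
⋆-sucʳ f g (suc n) = begin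
  f 0 * g (suc (suc n)) + ((f ∘ suc) ⋆ g) (suc n)
    ≡⟨ cong (_+_ (f 0 * g (suc (suc n)))) (⋆-sucʳ (f ∘ suc) g n) ⟩
  f 0 * g (suc (suc n)) + (((f ∘ suc) ⋆ (g ∘ suc)) n + f (suc (suc n)) * g 0)
    ≡⟨ sym (+-assoc (f 0 * g (suc (suc n))) _ _) ⟩
  (f ⋆ (g ∘ suc)) (suc n) + f (suc (suc n)) * g 0
    ∎
  where open ≡-Reasoning

-- The term f i * g j, where i + j = n, receives the weight (c + i) + suc j = c + suc n.
⋆-weighted : ∀ c f g n →
  ((λ i → (c + i) * f i) ⋆ g) n + (f ⋆ (λ j → suc j * g j)) n ≡ (c + suc n) * (f ⋆ g) n
⋆-weighted c f g zero = solve 3 (λ c x y → (c :+ con 0) :* x :* y :+ x :* (con 1 :* y)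
                                         := (c :+ con 1) :* (x :* y)) refl c (f 0) (g 0)
  where open +-*-Solver
⋆-weighted c f g (suc n) = begin
  (c + 0) * f 0 * g (suc n) + ((λ i → (c + suc i) * f (suc i)) ⋆ g) n
    + (f 0 * (suc (suc n) * g (suc n)) + ((f ∘ suc) ⋆ (λ j → suc j * g j)) n)
    ≡⟨ cong (λ t → (c + 0) * f 0 * g (suc n) + t + (f 0 * (suc (suc n) * g (suc n)) + r))
            (⋆-congˡ g (λ i → cong (_* f (suc i)) (+-suc c i)) n) ⟩
  (c + 0) * f 0 * g (suc n) + l + (f 0 * (suc (suc n) * g (suc n)) + r)
    ≡⟨ solve 6 (λ c n x y l r → (c :+ con 0) :* x :* y :+ l :+ (x :* ((con 2 :+ n) :* y) :+ r)
                               := (c :+ con 0) :* x :* y :+ x :* ((con 2 :+ n) :* y) :+ (l :+ r))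
         refl c n (f 0) (g (suc n)) l r ⟩
  (c + 0) * f 0 * g (suc n) + f 0 * (suc (suc n) * g (suc n)) + (l + r)
    ≡⟨ cong (_+_ ((c + 0) * f 0 * g (suc n) + f 0 * (suc (suc n) * g (suc n))))
            (⋆-weighted (suc c) (f ∘ suc) g n) ⟩
  (c + 0) * f 0 * g (suc n) + f 0 * (suc (suc n) * g (suc n)) + (suc c + suc n) * ((f ∘ suc) ⋆ g) n
    ≡⟨ solve 5 (λ c n x y z → (c :+ con 0) :* x :* y :+ x :* ((con 2 :+ n) :* y)
                                :+ (con 1 :+ c :+ (con 1 :+ n)) :* z
                            := (c :+ (con 2 :+ n)) :* (x :* y :+ z))
         refl c n (f 0) (g (suc n)) (((f ∘ suc) ⋆ g) n) ⟩
  (c + suc (suc n)) * (f ⋆ g) (suc n)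
    ∎
  where
  open ≡-Reasoning; open +-*-Solver
  l r : ℕ
  l = ((λ i → (suc c + i) * f (suc i)) ⋆ g) n
  r = ((f ∘ suc) ⋆ (λ j → suc j * g j)) n

!⋆!-suc : ∀ n → 2 * (_! ⋆ _!) (suc n) ≡ suc (suc n) * (_! ⋆ _!) n + 2 * suc n !
!⋆!-suc n = begin
  2 * (_! ⋆ _!) (suc n)
    ≡⟨ cong (λ y → (_! ⋆ _!) (suc n) + (y + 0)) (⋆-sucʳ _! _! n) ⟩
  (1 * suc n ! + shiftedˡ) + (shiftedʳ + suc n ! * 1 + 0)
    ≡⟨ solve 3 (λ x y f → (con 1 :* f :+ x) :+ (y :+ f :* con 1 :+ con 0) := (x :+ y) :+ con 2 :* f)
         refl shiftedˡ shiftedʳ (suc n !) ⟩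
  (shiftedˡ + shiftedʳ) + 2 * suc n !
    ≡⟨ cong (_+ 2 * suc n !) (⋆-weighted 1 _! _! n) ⟩
  suc (suc n) * (_! ⋆ _!) n + 2 * suc n !
    ∎
  where
  open ≡-Reasoning; open +-*-Solver
  shiftedˡ shiftedʳ : ℕ
  shiftedˡ = ((_! ∘ suc) ⋆ _!) n
  shiftedʳ = (_! ⋆ (_! ∘ suc)) n

p/d*q+r≡s : ∀ p q r s d .{{_ : NonZero d}} →
  + d ℤ.* s ≡ p ℤ.* q ℤ.+ + d ℤ.* r → (p / d) ℚ.* (q / 1) ℚ.+ r / 1 ≡ s / 1
p/d*q+r≡s p q r s d@(suc d-1) eq = toℚᵘ-injective (let open ℚᵘ.≃-Reasoning in begin
  toℚᵘ ((p / d) ℚ.* (q / 1) ℚ.+ r / 1)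
    ≈⟨ ℚᵘ.≃-trans (toℚᵘ-homo-+ (p / d ℚ.* (q / 1)) (r / 1))
                  (ℚᵘ.+-cong (toℚᵘ-homo-* (p / d) (q / 1)) ℚᵘ.≃-refl) ⟩
  toℚᵘ (p / d) ℚᵘ.* toℚᵘ (q / 1) ℚᵘ.+ toℚᵘ (r / 1)
    ≈⟨ ℚᵘ.+-cong (ℚᵘ.*-cong (toℚᵘ-fromℚᵘ (ℚᵘ.mkℚᵘ p d-1)) (toℚᵘ-fromℚᵘ (ℚᵘ.mkℚᵘ q 0)))
                (toℚᵘ-fromℚᵘ (ℚᵘ.mkℚᵘ r 0)) ⟩
  ℚᵘ.mkℚᵘ p d-1 ℚᵘ.* ℚᵘ.mkℚᵘ q 0 ℚᵘ.+ ℚᵘ.mkℚᵘ r 0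
    ≈⟨ ℚᵘ.*≡* cross-multiplied ⟩
  ℚᵘ.mkℚᵘ s 0
    ≈⟨ ℚᵘ.≃-sym (toℚᵘ-fromℚᵘ (ℚᵘ.mkℚᵘ s 0)) ⟩
  toℚᵘ (s / 1)
    ∎)
  where
  cross-multiplied : (p ℤ.* q ℤ.* + 1 ℤ.+ r ℤ.* (+ d ℤ.* + 1)) ℤ.* + 1 ≡ s ℤ.* (+ d ℤ.* + 1 ℤ.* + 1)
  cross-multiplied = begin
    (p ℤ.* q ℤ.* + 1 ℤ.+ r ℤ.* (+ d ℤ.* + 1)) ℤ.* + 1
      ≡⟨ solve 4 (λ p q r d → (p :* q :* con (+ 1) :+ r :* (d :* con (+ 1))) :* con (+ 1) := p :* q :+ d :* r)
           refl p q r (+ d) ⟩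
    p ℤ.* q ℤ.+ + d ℤ.* r
      ≡⟨ sym eq ⟩
    + d ℤ.* s
      ≡⟨ solve 2 (λ s d → d :* s := s :* (d :* con (+ 1) :* con (+ 1))) refl s (+ d) ⟩
    s ℤ.* (+ d ℤ.* + 1 ℤ.* + 1)
      ∎
    where open ≡-Reasoning; open ℤ-Solver

aℕ : ℕ → ℕ
aℕ zero    = 0
aℕ (suc n) = (_! ⋆ _!) n

aℕ-suc : ∀ n → 2 * aℕ (suc n) ≡ suc n * aℕ n + 2 * n !
aℕ-suc zero    = refl
aℕ-suc (suc n) = !⋆!-suc n

a≡aℕ : ∀ n → a n ≡ + aℕ n / 1
a≡aℕ zero    = refl
a≡aℕ (suc n) = trans (cong (λ x → ((+ suc n) / 2) ℚ.* x ℚ.+ (+ (n !)) / 1) (a≡aℕ n))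
                     (p/d*q+r≡s (+ suc n) (+ aℕ n) (+ (n !)) (+ aℕ (suc n)) 2 aℕ-sucℤ)
  where
  aℕ-sucℤ : + 2 ℤ.* + aℕ (suc n) ≡ + suc n ℤ.* + aℕ n ℤ.+ + 2 ℤ.* + (n !)
  aℕ-sucℤ = begin
    + 2 ℤ.* + aℕ (suc n)            ≡⟨ ℤ.pos-* 2 (aℕ (suc n)) ⟨
    + (2 * aℕ (suc n))              ≡⟨ cong +_ (aℕ-suc n) ⟩
    + (suc n * aℕ n + 2 * n !)      ≡⟨ ℤ.pos-+ (suc n * aℕ n) (2 * n !) ⟩
    + (suc n * aℕ n) ℤ.+ + (2 * n !) ≡⟨ cong₂ ℤ._+_ (ℤ.pos-* (suc n) (aℕ n)) (ℤ.pos-* 2 (n !)) ⟩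
    + suc n ℤ.* + aℕ n ℤ.+ + 2 ℤ.* + (n !) ∎
    where open ≡-Reasoning

corollary2 : (n : ℕ) → ∃ λ (z : ℤ) → a n ≡ z / 1
corollary2 n = + aℕ n , a≡aℕ n
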